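{- Every language defined by a predecessor Horn formula in normal form is in $\mathtt{RealTime}_{\mathtt{OIA}}$, i.e., is accepted in real time by a one-way iterative array.
   Context: Word structures: for a finite alphabet $\Sigma$ and a nonempty word $w=w_1\dots w_n\in\Sigma^n$, let $\langle w\rangle=([1,n];(Q_s)_{s\in\Sigma},\mathtt{min},\mathtt{max},\mathtt{suc},\mathtt{pred})$ with $Q_s(i)\iff w_i=s$, $\mathtt{min}(i)\iff i=1$, $\mathtt{max}(i)\iff i=n$, $\mathtt{pred}(i)=i-1$ for $i>1$, $\mathtt{pred}(1)=1$ (and $\mathtt{suc}$ symmetrically); $x-1$ denotes $\mathtt{pred}(x)$. A formula $\Phi$ defines $\{w\in\Sigma^+:\langle w\rangle\models\Phi\}$. A predecessor Horn formula in normal form is $\Phi=\exists\mathbf{R}\,\forall x\forall y\,\psi(x,y)$ with $\mathbf{R}$ a finite set of binary predicate symbols and $\psi$ a finite conjunction of clauses of the forms: input clauses $\mathtt{min}(x)\wedge\mathtt{min}(y)\wedge Q_s(y)\to R(x,y)$ or $\mathtt{min}(x)\wedge\neg\mathtt{min}(y)\wedge Q_s(y)\to R(x,y)$ ($s\in\Sigma$, $R\in\mathbf{R}$); the contradiction clause $\mathtt{max}(x)\wedge\mathtt{max}(y)\wedge R_\bot(x,y)\to\bot$ for a fixed $R_\bot\in\mathbf{R}$; computation clauses $\delta_1\wedge\dots\wedge\delta_r\to R(x,y)$ with each $\delta_i$ of the form $S(x-1,y)\wedge\neg\mathtt{min}(x)$ or $S(x,y-1)\wedge\neg\mathtt{min}(y)$,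 $S\in\mathbf{R}$. One-way iterative arrays: cells indexed by $[1,n]$ for input length $n$, each a finite automaton over a finite state set $Q$, cells outside $[1,n]$ permanently in a state $\sharp$, cells initially in a quiescent state $\lambda$; synchronously, the state of cell $c\ge2$ at time $t$ is determined by the states of cells $c-1$ and $c$ at time $t-1$ (neighborhood $\{ -1,0\}$), and the first cell at time $t$ additionally reads the input letter $w_t$ (sequential input; the input is fed on cell 1, letter $w_i$ at time $i$). $\mathtt{RealTime}_{\mathtt{OIA}}$: languages $L$ for which such an automaton with a set of accepting states exists such that $w\in L$ iff the last cell $n$ is in an accepting state at time $2n-1$ (the first time at which cell $n$ has received information from every input letter). -}

module Defs where

open import Data.Nat using (ℕ; zero; suc; _+_; _≤_)
open import Data.Fin using (Fin; zero; suc; inject₁; fromℕ)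
open import Data.Vec using (Vec; lookup)
open import Data.List using (List)
open import Data.List.NonEmpty using (List⁺; toList)
open import Data.List.Relation.Unary.All using (All)
open import Data.Maybe using (Maybe; just; nothing)
open import Data.Bool using (Bool; true)
open import Data.Product using (Σ; _×_; ∃)
open import Data.Empty using (⊥)
open import Relation.Nullary using (¬_)
open import Relation.Binary.PropositionalEquality using (_≡_)
open import Function.Bundles using (_⇔_)

-- Alphabet Σ = Fin k.  A nonempty word of length m = suc n is a
-- Vec (Fin k) (suc n); positions 1..m of the paper are Fin (suc n)
-- (position i of the paper is the element with toℕ = i - 1).

Language : ℕ → Set₂
Language k = (n : ℕ) → Vec (Fin k) (suc n) → Set₁

module WordStructure {k n : ℕ} (w : Vec (Fin k) (suc n)) where

  Pos : Set
  Pos = Fin (suc n)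

  Q : Fin k → Pos → Set
  Q s i = lookup w i ≡ s

  min : Pos → Set
  min i = i ≡ zero

  max : Pos → Set
  max i = i ≡ fromℕ n

  pred : Pos → Pos
  pred zero    = zero
  pred (suc i) = inject₁ i

  -- suc(i) = i + 1 for i < n, suc(n) = n
  sucP : Pos → Pos
  sucP i = go n i
    where
    go : (m : ℕ) → Fin (suc m) → Fin (suc m)
    go zero    zero    = zero
    go (suc m) zero    = suc zero
    go (suc m) (suc j) = suc (go m j)

-- hypothesis δ of a computation clause:
--   viaX S  stands for  S(x-1,y) ∧ ¬min(x)
--   viaY S  stands for  S(x,y-1) ∧ ¬min(y)
data Hyp (r : ℕ) : Set where
  viaX : Fin r → Hyp r
  viaY : Fin r → Hyp r

data Clause (k r : ℕ) : Set where
  inputMin    : (s : Fin k) (R : Fin r) → Clause k r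
  inputNonMin : (s : Fin k) (R : Fin r) → Clause k r
  -- max(x) ∧ max(y) ∧ R_⊥(x,y) → ⊥   (R_⊥ fixed by the formula)
  contradiction : Clause k r
  computation : (δs : List⁺ (Hyp r)) (R : Fin r) → Clause k r

record HornNF (k : ℕ) : Set where
  field
    nRel    : ℕ
    Rbot    : Fin nRel
    clauses : List (Clause k nRel)

module _ {k n : ℕ} (w : Vec (Fin k) (suc n)) where
  open WordStructure w

  Interp : ℕ → Set₁
  Interp r = Fin r → Pos → Pos → Set

  HypHolds : {r : ℕ} → Interp r → Pos → Pos → Hyp r → Set
  HypHolds ρ x y (viaX S) = ρ S (pred x) y × ¬ min x
  HypHolds ρ x y (viaY S) = ρ S x (pred y) × ¬ min y

  ClauseHolds : {r : ℕ} → Fin r → Interp r → Pos → Pos → Clause k r → Set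
  ClauseHolds Rb ρ x y (inputMin s R)    = min x → min y → Q s y → ρ R x y
  ClauseHolds Rb ρ x y (inputNonMin s R) = min x → ¬ min y → Q s y → ρ R x y
  ClauseHolds Rb ρ x y contradiction     = max x → max y → ρ Rb x y → ⊥
  ClauseHolds Rb ρ x y (computation δs R) =
    All (HypHolds ρ x y) (toList δs) → ρ R x y

  _⊨_ : HornNF k → Set₁
  _⊨_ Φ = Σ (Interp (HornNF.nRel Φ)) λ ρ →
            (x y : Pos) → All (ClauseHolds (HornNF.Rbot Φ) ρ x y) (HornNF.clauses Φ)

DefinedBy : {k : ℕ} → HornNF k → Language k
DefinedBy Φ n w = w ⊨ Φ

record OIA (k : ℕ) : Set where
  field
    q         : ℕ
    sharp     : Fin q                               -- ♯ (cells outside [1,n])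
    quiescent : Fin q
    -- cell c ≥ 2 : new state from (state of c-1, state of c)
    δ         : Fin q → Fin q → Fin q
    -- cell 1 : new state from (state of cell 0 = ♯, own state,
    --          input letter; nothing once the input is exhausted)
    δ₁        : Fin q → Fin q → Maybe (Fin k) → Fin q
    accepting : Fin q → Bool

module _ {k : ℕ} (A : OIA k) where
  open OIA A

  -- input letter fed to cell 1 at time t+1 (w_{t+1}), if any
  inputAt : {m : ℕ} → Vec (Fin k) m → ℕ → Maybe (Fin k)
  inputAt {zero}  _ _ = nothing
  inputAt {suc m} w zero    = just (lookup w zero)
  inputAt {suc m} w (suc t) = inputAt {m} (Data.Vec.tail w) t

  -- run A w c t = state of cell c+1 at time t
  run : {m : ℕ} → Vec (Fin k) m → ℕ → ℕ → Fin q
  run w c       zero    = quiescent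
  run w zero    (suc t) = δ₁ sharp (run w zero t) (inputAt w t)
  run w (suc c) (suc t) = δ (run w c t) (run w (suc c) t)

  -- w (of length n+1) is accepted iff cell n+1 is accepting at time 2(n+1)-1
  Accepts : {n : ℕ} → Vec (Fin k) (suc n) → Set
  Accepts {n} w = accepting (run w n (suc (n + n))) ≡ true

RealTimeOIA : {k : ℕ} → Language k → Set₁
RealTimeOIA {k} L = Σ (OIA k) λ A →
  (n : ℕ) (w : Vec (Fin k) (suc n)) → L n w ⇔ Accepts A w

module Submission where

-- A predecessor Horn formula in normal form has a least model: every computation clause
-- derives a fact at (x, y) from facts at (x - 1, y) and (x, y - 1), so forward chaining
-- settles the relations holding at (x, y) once those at both predecessors are known, and
-- the formula holds iff this least model does not put R_⊥ at (n, n) (when the contradiction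
-- clause is present).  Cell x of the array stores the facts at (x, y) at time x + y - 1: it
-- receives those at (x - 1, y) from its left neighbour and those at (x, y - 1) from its own
-- previous state, and cell 1 reads w_y directly.  So cell n knows the facts at (n, n) at
-- time 2n - 1, which is real time.

open import Data.Nat using (ℕ; zero; suc; _+_; _≤_; _^_; s≤s)
open import Data.Nat.Properties using (+-suc; +-identityʳ; ≤-refl)
open import Data.Fin using (Fin; zero; suc; toℕ; inject₁; fromℕ; _≟_)
open import Data.Fin.Properties using (2↔Bool; toℕ-inject₁; toℕ-fromℕ)
open import Data.Fin.Induction using (<-weakInduction)
open import Data.Vec using (Vec; _∷_; lookup; tabulate)
open import Data.Vec.Properties using (lookup∘tabulate)
open import Data.Vec.Recursive using (fromVec; toVec; lift↔; Fin[m^n]↔Fin[m]^n)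
open import Data.Vec.Recursive.Properties using (fromVec∘toVec; toVec∘fromVec)
open import Data.Bool.ListAction using (any; all)
open import Data.List.NonEmpty using (toList)
open import Data.List.Relation.Unary.All as All using (All)
open import Data.List.Relation.Unary.All.Properties using (all⁺; all⁻)
open import Data.List.Relation.Unary.Any using (Any)
open import Data.List.Relation.Unary.Any.Properties using (any⇔)
open import Data.List.Membership.Propositional using (_∈_; find; lose)
open import Data.Maybe using (Maybe; just; nothing; maybe; is-just; is-nothing)
open import Data.Bool using (Bool; true; false; T; not; _∧_)
open import Data.Bool.Properties using (T-∧)
open import Data.Product using (_×_; _,_; proj₁; proj₂)
open import Data.Product.Function.NonDependent.Propositional using (_×-⇔_)
open import Data.Unit using (tt)
open import Data.Empty using (⊥; ⊥-elim)
open import Relation.Nullary using (¬_)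
open import Relation.Nullary.Decidable using (⌊_⌋; toWitness; fromWitness)
open import Relation.Binary.PropositionalEquality using (_≡_; refl; sym; cong; subst)
open import Function using (_∘_; id)
open import Function.Bundles using (_⇔_; mk⇔; _↔_; mk↔ₛ′; Inverse; Equivalence)
open import Function.Properties.Inverse using (↔-sym; ↔-trans)
open import Function.Construct.Composition using (_⇔-∘_)
open import Function.Properties.Equivalence using () renaming (sym to ⇔-sym)
open import Defs

open Equivalence using (to; from)

Vec-Bool↔Fin : (r : ℕ) → Vec Bool r ↔ Fin (2 ^ r)
Vec-Bool↔Fin r =
  ↔-trans (mk↔ₛ′ fromVec (toVec r) (fromVec∘toVec r) toVec∘fromVec)
    (↔-trans (lift↔ r (↔-sym 2↔Bool)) (↔-sym (Fin[m^n]↔Fin[m]^n 2 r)))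

encode : ∀ {r} → Maybe (Vec Bool r) → Fin (suc (2 ^ r))
encode         nothing  = zero
encode {r = r} (just v) = suc (Inverse.to (Vec-Bool↔Fin r) v)

decode : ∀ {r} → Fin (suc (2 ^ r)) → Maybe (Vec Bool r)
decode         zero    = nothing
decode {r = r} (suc i) = just (Inverse.from (Vec-Bool↔Fin r) i)

decode-encode : ∀ {r} (m : Maybe (Vec Bool r)) → decode (encode m) ≡ m
decode-encode         nothing  = refl
decode-encode {r = r} (just v) = cong just (Inverse.strictlyInverseʳ (Vec-Bool↔Fin r) v)

T-≟ : ∀ {m} (i j : Fin m) → T ⌊ i ≟ j ⌋ ⇔ (i ≡ j)
T-≟ i j = mk⇔ toWitness fromWitness

¬T⇔not≡true : ∀ {b} → (¬ T b) ⇔ (not b ≡ true)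
¬T⇔not≡true {false} = mk⇔ (λ _ → refl) (λ _ ())
¬T⇔not≡true {true}  = mk⇔ (λ ¬t → ⊥-elim (¬t tt)) (λ ())

inputAt-toℕ : ∀ {k m} (A : OIA k) (w : Vec (Fin k) m) (i : Fin m) →
              inputAt A w (toℕ i) ≡ just (lookup w i)
inputAt-toℕ A (a ∷ w) zero    = refl
inputAt-toℕ A (a ∷ w) (suc i) = inputAt-toℕ A w i

module _ {k n : ℕ} (w : Vec (Fin k) (suc n)) {r : ℕ} where
  open WordStructure w

  Included : Interp w r → Interp w r → Pos → Pos → Set
  Included ρ ρ′ x y = ∀ R → ρ R x y → ρ′ R x y

  Derives : Interp w r → Pos → Pos → Fin r → Clause k r → Set
  Derives ρ x y R (inputMin s R′)     = R ≡ R′ × min y × min x × Q s y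
  Derives ρ x y R (inputNonMin s R′)  = R ≡ R′ × ¬ min y × min x × Q s y
  Derives ρ x y R contradiction       = ⊥
  Derives ρ x y R (computation δs R′) = R ≡ R′ × All (HypHolds w ρ x y) (toList δs)

  ClauseHolds⇒closed : ∀ {Rb ρ x y R} c →
                       ClauseHolds w Rb ρ x y c → Derives ρ x y R c → ρ R x y
  ClauseHolds⇒closed (inputMin s R)     holds (refl , my , mx , q)  = holds mx my q
  ClauseHolds⇒closed (inputNonMin s R)  holds (refl , ¬my , mx , q) = holds mx ¬my q
  ClauseHolds⇒closed (computation δs R) holds (refl , hyps)         = holds hyps

  module _ {ρ ρ′ : Interp w r} {x y : Pos}
           (left : ¬ min x → Included ρ ρ′ (pred x) y)
           (below : ¬ min y → Included ρ ρ′ x (pred y)) where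

    HypHolds-mono : ∀ h → HypHolds w ρ x y h → HypHolds w ρ′ x y h
    HypHolds-mono (viaX S) (p , ¬mx) = left ¬mx S p , ¬mx
    HypHolds-mono (viaY S) (p , ¬my) = below ¬my S p , ¬my

    Derives-mono : ∀ {R} c → Derives ρ x y R c → Derives ρ′ x y R c
    Derives-mono (inputMin s R′)     d            = d
    Derives-mono (inputNonMin s R′)  d            = d
    Derives-mono (computation δs R′) (eq , hyps)  = eq , All.map (HypHolds-mono _) hyps

module Construction {k : ℕ} (Φ : HornNF k) where
  open HornNF Φ renaming (nRel to r)

  data FromLeft : Set where
    input : Maybe (Fin k) → FromLeft
    cell  : Vec Bool r → FromLeft

  reads : FromLeft → Fin k → Bool
  reads (input (just a)) s = ⌊ a ≟ s ⌋
  reads _                s = false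

  holds : FromLeft → Maybe (Vec Bool r) → Hyp r → Bool
  holds _         b (viaY S) = maybe (λ v → lookup v S) false b
  holds (cell v)  _ (viaX S) = lookup v S
  holds (input _) _ (viaX S) = false

  fires : FromLeft → Maybe (Vec Bool r) → Fin r → Clause k r → Bool
  fires l b R (inputMin s R′)     = ⌊ R ≟ R′ ⌋ ∧ is-nothing b ∧ reads l s
  fires l b R (inputNonMin s R′)  = ⌊ R ≟ R′ ⌋ ∧ is-just b ∧ reads l s
  fires l b R contradiction       = false
  fires l b R (computation δs R′) = ⌊ R ≟ R′ ⌋ ∧ all (holds l b) (toList δs)

  step : FromLeft → Maybe (Vec Bool r) → Vec Bool r
  step l b = tabulate λ R → any (fires l b R) clauses

  isContradiction : Clause k r → Bool
  isContradiction contradiction = true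
  isContradiction _             = false

  inconsistent : Vec Bool r → Bool
  inconsistent v = any isContradiction clauses ∧ lookup v Rbot

  contradiction-∈ : T (any isContradiction clauses) → contradiction ∈ clauses
  contradiction-∈ t with find {P = T ∘ isContradiction} (from any⇔ t)
  ... | contradiction , c∈ , _ = c∈

  module Facts (letter : ℕ → Maybe (Fin k)) where
    mutual
      facts : ℕ → ℕ → Vec Bool r
      facts x y = step (fromLeft x y) (fromBelow x y)

      fromLeft : ℕ → ℕ → FromLeft
      fromLeft zero    y = input (letter y)
      fromLeft (suc x) y = cell (facts x y)

      fromBelow : ℕ → ℕ → Maybe (Vec Bool r)
      fromBelow x zero    = nothing
      fromBelow x (suc y) = just (facts x y)

  module LeastModel {n : ℕ} (w : Vec (Fin k) (suc n)) (letter : ℕ → Maybe (Fin k))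
                    (letter-toℕ : ∀ i → letter (toℕ i) ≡ just (lookup w i)) where
    open Facts letter
    open WordStructure w

    least : Interp w r
    least R x y = T (lookup (facts (toℕ x) (toℕ y)) R)

    leftAt : Pos → Pos → FromLeft
    leftAt x y = fromLeft (toℕ x) (toℕ y)

    belowAt : Pos → Pos → Maybe (Vec Bool r)
    belowAt x y = fromBelow (toℕ x) (toℕ y)

    firesAt : Pos → Pos → Fin r → Clause k r → Bool
    firesAt x y = fires (leftAt x y) (belowAt x y)

    least⇔firesAt : ∀ {R x y} → least R x y ⇔ Any (T ∘ firesAt x y R) clauses
    least⇔firesAt {R} {x} {y}
      rewrite lookup∘tabulate (λ R → any (firesAt x y R) clauses) R = ⇔-sym any⇔

    reads⇔ : ∀ {x y s} → T (reads (leftAt x y) s) ⇔ (min x × Q s y)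
    reads⇔ {zero}  {y} rewrite letter-toℕ y =
      mk⇔ (λ t → refl , toWitness t) (fromWitness ∘ proj₂)
    reads⇔ {suc x}     = mk⇔ (λ ()) (λ { (() , _) })

    is-nothing⇔ : ∀ {i y} → T (is-nothing (fromBelow i (toℕ y))) ⇔ min y
    is-nothing⇔ {y = zero}  = mk⇔ (λ _ → refl) (λ _ → tt)
    is-nothing⇔ {y = suc y} = mk⇔ (λ ()) (λ ())

    is-just⇔ : ∀ {i y} → T (is-just (fromBelow i (toℕ y))) ⇔ (¬ min y)
    is-just⇔ {y = zero}  = mk⇔ (λ ()) (λ ¬m → ¬m refl)
    is-just⇔ {y = suc y} = mk⇔ (λ _ ()) (λ _ → tt)

    holds⇔ : ∀ {x y} h → T (holds (leftAt x y) (belowAt x y) h) ⇔ HypHolds w least x y h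
    holds⇔ {zero}  (viaX S) = mk⇔ (λ ()) (λ (_ , ¬m) → ¬m refl)
    holds⇔ {suc x} (viaX S) rewrite toℕ-inject₁ x = mk⇔ (λ t → t , λ ()) proj₁
    holds⇔ {y = zero}  (viaY S) = mk⇔ (λ ()) (λ (_ , ¬m) → ¬m refl)
    holds⇔ {y = suc y} (viaY S) rewrite toℕ-inject₁ y = mk⇔ (λ t → t , λ ()) proj₁

    all-holds⇔ : ∀ {x y} hs → T (all (holds (leftAt x y) (belowAt x y)) hs)
                             ⇔ All (HypHolds w least x y) hs
    all-holds⇔ hs =
      mk⇔ (All.map (to (holds⇔ _)) ∘ all⁺ _ hs) (all⁻ _ ∘ All.map (from (holds⇔ _)))

    fires⇔Derives : ∀ {x y R} c → T (firesAt x y R c) ⇔ Derives w least x y R c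
    fires⇔Derives {R = R} (inputMin s R′)     =
      (T-≟ R R′ ×-⇔ (is-nothing⇔ ×-⇔ reads⇔) ⇔-∘ T-∧) ⇔-∘ T-∧
    fires⇔Derives {R = R} (inputNonMin s R′)  =
      (T-≟ R R′ ×-⇔ (is-just⇔ ×-⇔ reads⇔) ⇔-∘ T-∧) ⇔-∘ T-∧
    fires⇔Derives         contradiction       = mk⇔ (λ ()) (λ ())
    fires⇔Derives {R = R} (computation δs R′) =
      (T-≟ R R′ ×-⇔ all-holds⇔ (toList δs)) ⇔-∘ T-∧

    least-closed : ∀ {x y R c} → c ∈ clauses → Derives w least x y R c → least R x y
    least-closed {c = c} c∈ d = from least⇔firesAt (lose c∈ (from (fires⇔Derives c) d))

    module _ (ρ : Interp w r) (model : ∀ x y → All (ClauseHolds w Rbot ρ x y) clauses) where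

      least-step : ∀ {x y} → (¬ min x → Included w least ρ (pred x) y) →
                   (¬ min y → Included w least ρ x (pred y)) → Included w least ρ x y
      least-step {x} {y} left below R t with find (to least⇔firesAt t)
      ... | c , c∈ , fc = ClauseHolds⇒closed w c (All.lookup (model x y) c∈)
                            (Derives-mono w left below c (to (fires⇔Derives c) fc))

      least-minimal : ∀ x y → Included w least ρ x y
      least-minimal = <-weakInduction (λ x → ∀ y → Included w least ρ x y)
                        (row (λ ¬m → ⊥-elim (¬m refl))) (λ _ ih → row (λ _ → ih))
        where
        row : ∀ {x} → (¬ min x → ∀ y → Included w least ρ (pred x) y) →
              ∀ y → Included w least ρ x y
        row ih = <-weakInduction (λ y → Included w least ρ _ y)
                   (least-step (λ ¬m → ih ¬m zero) (λ ¬m → ⊥-elim (¬m refl)))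
                   (λ y ih′ → least-step (λ ¬m → ih ¬m (suc y)) (λ _ → ih′))

    least-at-max : ∀ {R} → least R (fromℕ n) (fromℕ n) ≡ T (lookup (facts n n) R)
    least-at-max {R} = cong (λ i → T (lookup (facts i i) R)) (toℕ-fromℕ n)

    least-model : ¬ T (inconsistent (facts n n)) →
                  ∀ x y → All (ClauseHolds w Rbot least x y) clauses
    least-model consistent x y = All.tabulate (clause x y)
      where
      clause : ∀ {c} x y → c ∈ clauses → ClauseHolds w Rbot least x y c
      clause {inputMin s R}     x y c∈ mx my q   = least-closed c∈ (refl , my , mx , q)
      clause {inputNonMin s R}  x y c∈ mx ¬my q  = least-closed c∈ (refl , ¬my , mx , q)
      clause {computation δs R} x y c∈ hyps      = least-closed c∈ (refl , hyps)
      clause {contradiction}    _ _ c∈ refl refl t =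
        consistent (from T-∧ (to any⇔ (lose c∈ tt) , subst id least-at-max t))

    ⊨⇔consistent : w ⊨ Φ ⇔ (¬ T (inconsistent (facts n n)))
    ⊨⇔consistent = mk⇔ consistent (λ c → least , least-model c)
      where
      consistent : w ⊨ Φ → ¬ T (inconsistent (facts n n))
      consistent (ρ , model) t with to T-∧ t
      ... | has , t-bot =
        All.lookup (model (fromℕ n) (fromℕ n)) (contradiction-∈ has) refl refl
          (least-minimal ρ model (fromℕ n) (fromℕ n) Rbot (subst id (sym least-at-max) t-bot))

  advance : Maybe (Vec Bool r) → Maybe (Vec Bool r) → Maybe (Vec Bool r)
  advance nothing  _ = nothing
  advance (just v) b = just (step (cell v) b)

  -- The state nothing stands for both ♯ and λ: a cell stays quiescent until its left
  -- neighbour has become active.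
  array : OIA k
  array = record
    { q         = suc (2 ^ r)
    ; sharp     = zero
    ; quiescent = zero
    ; δ         = λ left self → encode (advance (decode left) (decode self))
    ; δ₁        = λ _ self a → encode (just (step (input a) (decode self)))
    ; accepting = maybe (not ∘ inconsistent) true ∘ decode
    }

  module Run {n : ℕ} (w : Vec (Fin k) (suc n)) where
    open Facts (inputAt array w)

    run-quiescent : ∀ c t → t ≤ c → decode {r} (run array w c t) ≡ nothing
    run-quiescent c       zero    _         = refl
    run-quiescent (suc c) (suc t) (s≤s t≤c) rewrite run-quiescent c t t≤c = refl

    mutual
      run-facts : ∀ c y → decode {r} (run array w c (suc (c + y))) ≡ just (facts c y)
      run-facts zero    y rewrite run-below zero y                  = decode-encode _
      run-facts (suc c) y rewrite run-facts c y | run-below (suc c) y = decode-encode _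

      run-below : ∀ c y → decode {r} (run array w c (c + y)) ≡ fromBelow c y
      run-below c zero    rewrite +-identityʳ c = run-quiescent c c ≤-refl
      run-below c (suc y) rewrite +-suc c y     = run-facts c y

    Accepts⇔consistent : Accepts array w ⇔ (¬ T (inconsistent (facts n n)))
    Accepts⇔consistent rewrite run-facts n n = ⇔-sym ¬T⇔not≡true

lemma4 : (k : ℕ) (Φ : HornNF k) → RealTimeOIA (DefinedBy Φ)
lemma4 k Φ = array , λ n w →
  ⇔-sym (Run.Accepts⇔consistent w)
    ⇔-∘ LeastModel.⊨⇔consistent w (inputAt array w) (inputAt-toℕ array w)
  where open Construction Φ
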